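{- The operators $\tilde u_i=u_i(1+d_{\mu,i})$, $i\ge1$, on $M$ satisfy: (i) $\tilde u_i\tilde u_k\tilde u_j=\tilde u_k\tilde u_i\tilde u_j$ for $i<j<k$; (ii) $\tilde u_j\tilde u_k\tilde u_i=\tilde u_j\tilde u_i\tilde u_k$ for $i<j<k$; (iii) $\tilde u_j(\tilde u_i\tilde u_j-\tilde u_j\tilde u_i)=(\tilde u_i\tilde u_j-\tilde u_j\tilde u_i)\tilde u_i$ for $i<j$.
   Context: Fix a partition $\mu$ and indeterminates $\alpha,\beta$. Let $M$ be the $\mathbb{Z}[\alpha,\beta]$-module of formal (possibly infinite) $\mathbb{Z}[\alpha,\beta]$-linear combinations of partitions $\lambda\supseteq\mu$. Column-adding operators: $u_i\cdot\lambda=\sum_{a\ge1}\alpha^{a-1}\lambda^{+a,i}$, summed over $a\ge1$ such that adding $a$ boxes to the bottom of the $i$-th column of $\lambda$ yields a partition $\lambda^{+a,i}$ (zero if none). Schur operators: $d_{\mu,i}\cdot\lambda=\beta\,\lambda^{ -i}$ if removing the bottom box of the $i$-th column of $\lambda$ yields a partition $\lambda^{ -i}\supseteq\mu$, and $0$ otherwise. Operators are extended linearly and composed right to left. -}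

module Defs where

open import Data.Nat using (ℕ; zero; suc; _+_; _∸_; _≤_; _<_; _≥_; _⊔_; _≡ᵇ_; _≤ᵇ_)
open import Data.Integer using (ℤ; 0ℤ) renaming (_+_ to _+ℤ_; -_ to -ℤ_)
open import Data.Bool using (Bool; if_then_else_; _∧_; _∨_)
open import Data.Product using (_×_; _,_)
open import Data.List using (List; []; _∷_; _++_; map; concatMap; upTo)
open import Data.List.Relation.Unary.All using (All)
open import Data.List.Relation.Unary.Linked using (Linked)
open import Relation.Binary.PropositionalEquality using (_≡_)

-- The coefficient ring ℤ[α,β].
-- A polynomial is a finite list of terms (i , j , c) meaning c·α^i·β^j;
-- two polynomials are equal iff all their coefficients agree.

Poly : Set
Poly = List (ℕ × ℕ × ℤ)

coeff : Poly → ℕ → ℕ → ℤ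
coeff [] m n = 0ℤ
coeff ((a , b , c) ∷ p) m n =
  if (a ≡ᵇ m) ∧ (b ≡ᵇ n) then c +ℤ coeff p m n else coeff p m n

mulMono : ℕ → ℕ → Poly → Poly
mulMono i j = map (λ { (a , b , c) → (i + a , j + b , c) })

negP : Poly → Poly
negP = map (λ { (a , b , c) → (a , b , -ℤ c) })

-- Partitions, encoded by their column lengths λ'_1 ≥ λ'_2 ≥ … > 0
-- (a finite list of positive, weakly decreasing naturals).

IsPartition : List ℕ → Set
IsPartition l = Linked _≥_ l × All (λ x → 0 < x) l

-- length of the i-th column (columns indexed from 1; 0 beyond the diagram)
col : List ℕ → ℕ → ℕ
col l zero = 0
col [] (suc i) = 0
col (x ∷ l) (suc zero) = x
col (x ∷ l) (suc (suc i)) = col l (suc i)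

_⊆P_ : List ℕ → List ℕ → Set
μ ⊆P ν = ∀ i → col μ i ≤ col ν i

set0 : List ℕ → ℕ → ℕ → List ℕ
set0 [] zero v = v ∷ []
set0 [] (suc i) v = 0 ∷ set0 [] i v
set0 (x ∷ l) zero v = v ∷ l
set0 (x ∷ l) (suc i) v = x ∷ set0 l i v

cons0 : ℕ → List ℕ → List ℕ
cons0 zero [] = []
cons0 x r = x ∷ r

strip : List ℕ → List ℕ
strip [] = []
strip (x ∷ l) = cons0 x (strip l)

withCol : List ℕ → ℕ → ℕ → List ℕ
withCol ν i v = strip (set0 ν (i ∸ 1) v)

-- The module M: formal (possibly infinite) ℤ[α,β]-combinations of
-- partitions λ ⊇ μ, represented by their coefficient function
-- λ ↦ (coefficient of λ).  Values at lists that are not partitions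
-- containing μ are irrelevant (never read by the operators below, and
-- ignored by the equality _≈M_).

M : Set
M = List ℕ → Poly

_⊕_ : M → M → M
(f ⊕ g) ν = f ν ++ g ν

_⊖_ : M → M → M
(f ⊖ g) ν = f ν ++ negP (g ν)

EqM : List ℕ → M → M → Set
EqM μ f g = ∀ ν → IsPartition ν → μ ⊆P ν →
  ∀ m n → coeff (f ν) m n ≡ coeff (g ν) m n

-- Column-adding operator u_i, λ ↦ Σ_{a≥1} α^{a-1} λ^{+a,i}, extended
-- linearly to M.  The coefficient of ν in u_i·f is
--   Σ_{a ≥ 1} α^{a-1} f(ν with column i shortened by a),
-- where a ranges over those values for which the shortened diagram is a
-- partition containing μ, i.e. 1 ≤ a ≤ ν'_i − max(ν'_{i+1}, μ'_i).
U : List ℕ → ℕ → M → M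
U μ i f ν =
  concatMap (λ a' → mulMono a' 0 (f (withCol ν i (col ν i ∸ suc a'))))
            (upTo (col ν i ∸ (col ν (suc i) ⊔ col μ i)))

-- Schur operator d_{μ,i}, λ ↦ β λ^{-i} (if λ^{-i} is a partition ⊇ μ),
-- extended linearly.  The coefficient of ν ⊇ μ in d_{μ,i}·f is
-- β·f(ν^{+1,i}) if adding one box to column i of ν gives a partition
-- (i.e. i = 1 or ν'_{i-1} ≥ ν'_i + 1), and 0 otherwise.
D : List ℕ → ℕ → M → M
D μ i f ν =
  if (i ≡ᵇ 1) ∨ (suc (col ν i) ≤ᵇ col ν (i ∸ 1))
  then mulMono 0 1 (f (withCol ν i (suc (col ν i))))
  else []

Ut : List ℕ → ℕ → M → M
Ut μ i f = U μ i (f ⊕ D μ i f)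

-- Coefficientwise, ũ_i only changes column i: the coefficient of ũ_i f at ν is
-- Σ_w α^(ν′_i - 1 - w) (f(ν_w) + β f(ν_(w+1))), summed over the shorter lengths w
-- of column i, the β-term present when d may add the box.  For columns at
-- distance at least two these sums run over independent variables, so ũ_i and
-- ũ_k commute; this gives (i) and (ii), and both sides of (iii) vanish when
-- j > i + 1.  For j = i + 1 only the lengths x ≥ y of the two columns vary.  In
-- these coordinates the commutator C = ũ_i ũ_j - ũ_j ũ_i satisfies
-- C(x + 1, y) = α C(x, y) and C(y, y) = -ũ_j ũ_i(y, y); hence both sides of
-- (iii) are multiplied by α whenever x grows beyond y, and it remains to compare
-- them on the diagonal x = y, by induction on y.

module Submission where

open import Defs
open import Data.Nat using (ℕ; _≤_; _<_)
open import Data.List using (List)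
open import Data.Product using (_×_)

open import Data.Nat
  using (zero; suc; _∸_; _⊔_; _≡ᵇ_; _≤ᵇ_; _≥_; _≤′_; ≤′-refl; ≤′-step; z≤n; s≤s; _≟_)
open import Data.Nat.Properties
  using (≤-refl; ≤-trans; <⇒≤; n≤1+n; m≤n⇒m≤1+n; m<n⇒m<1+n; _≤?_; ≰⇒>; ≤∧≢⇒<; <⇒≢; >⇒≢; 1+n≢n;
         m≤n⇒m∸n≡0; +-∸-assoc; m∸n≤m; ≤⇒≤ᵇ; ≤⇒≤′; ≤′⇒≤;
         m≤m⊔n; m≤n⊔m; m⊔n≤o⇒m≤o; ⊔-lub; ⊔-monoˡ-≤)
open import Data.Integer as ℤ using (ℤ; +_; -[1+_]; 0ℤ)
import Data.Integer.Properties as ℤ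
open import Data.Integer.Tactic.RingSolver using (solve-∀)
open import Data.Bool using (Bool; true; false; if_then_else_; _∧_; _∨_)
open import Data.Bool.Properties using (∨-zeroʳ; T-≡)
open import Data.List using ([]; _∷_; _++_; concatMap; upTo; applyUpTo)
open import Data.List.Properties using (map-++; map-upTo; concatMap-map; map-id; map-∘)
open import Data.List.Relation.Unary.All using (All; []; _∷_)
open import Data.List.Relation.Unary.Linked using (Linked; []; [-]; _∷_)
open import Data.Product using (_,_)
open import Data.Empty using (⊥-elim)
open import Function using (_∘_; const; Equivalence)
open import Level using (0ℓ)
open import Relation.Nullary using (yes; no)
open import Relation.Binary.Bundles using (Setoid)
open import Relation.Binary.PropositionalEquality using (_≡_; _≢_; refl; sym; trans; cong; cong₂; subst)
import Relation.Binary.Reasoning.Setoid as SetoidReasoning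

-- Power series in α and β

-- Exponents run over ℤ (negative ones carry zeros) so that multiplication by
-- α or β is a shift of an index, which commutes with every pointwise operation
-- on the nose.  η is switched off so that the operations stay visible to
-- unification.
record Series : Set where
  no-eta-equality
  field coeffˢ : ℤ → ℤ → ℤ
open Series

infix 4 _≈_
record _≈_ (u v : Series) : Set where
  constructor mk≈
  field pointwise : ∀ m n → coeffˢ u m n ≡ coeffˢ v m n
open _≈_

≈-setoid : Setoid 0ℓ 0ℓ
≈-setoid = record
  { Carrier = Series
  ; _≈_ = _≈_
  ; isEquivalence = record
    { refl = mk≈ λ _ _ → refl
    ; sym = λ p → mk≈ λ m n → sym (pointwise p m n)
    ; trans = λ p q → mk≈ λ m n → trans (pointwise p m n) (pointwise q m n)
    }
  }

open Setoid ≈-setoid using (reflexive) renaming (refl to ≈-refl; sym to ≈-sym; trans to ≈-trans)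
open SetoidReasoning ≈-setoid

infixl 6 _+ˢ_ _-ˢ_
infixr 8 -ˢ_ α·_ β·_

0ˢ : Series
coeffˢ 0ˢ _ _ = 0ℤ

_+ˢ_ : Series → Series → Series
coeffˢ (u +ˢ v) m n = coeffˢ u m n ℤ.+ coeffˢ v m n

-ˢ_ : Series → Series
coeffˢ (-ˢ u) m n = ℤ.- coeffˢ u m n

_-ˢ_ : Series → Series → Series
u -ˢ v = u +ˢ -ˢ v

α·_ : Series → Series
coeffˢ (α· u) m n = coeffˢ u (ℤ.pred m) n

β·_ : Series → Series
coeffˢ (β· u) m n = coeffˢ u m (ℤ.pred n)

+ˢ-cong : ∀ {u u′ v v′} → u ≈ u′ → v ≈ v′ → u +ˢ v ≈ u′ +ˢ v′
+ˢ-cong p q = mk≈ λ m n → cong₂ ℤ._+_ (pointwise p m n) (pointwise q m n)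

+ˢ-congˡ : ∀ {u v v′} → v ≈ v′ → u +ˢ v ≈ u +ˢ v′
+ˢ-congˡ = +ˢ-cong ≈-refl

+ˢ-congʳ : ∀ {u u′ v} → u ≈ u′ → u +ˢ v ≈ u′ +ˢ v
+ˢ-congʳ p = +ˢ-cong p ≈-refl

-ˢ-cong : ∀ {u v} → u ≈ v → -ˢ u ≈ -ˢ v
-ˢ-cong p = mk≈ λ m n → cong ℤ.-_ (pointwise p m n)

α·-cong : ∀ {u v} → u ≈ v → α· u ≈ α· v
α·-cong p = mk≈ λ m n → pointwise p (ℤ.pred m) n

β·-cong : ∀ {u v} → u ≈ v → β· u ≈ β· v
β·-cong p = mk≈ λ m n → pointwise p m (ℤ.pred n)

+ˢ-identityˡ : ∀ u → 0ˢ +ˢ u ≈ u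
+ˢ-identityˡ u = mk≈ λ m n → ℤ.+-identityˡ (coeffˢ u m n)

+ˢ-identityʳ : ∀ u → u +ˢ 0ˢ ≈ u
+ˢ-identityʳ u = mk≈ λ m n → ℤ.+-identityʳ (coeffˢ u m n)

+ˢ-interchange : ∀ u v w z → (u +ˢ v) +ˢ (w +ˢ z) ≈ (u +ˢ w) +ˢ (v +ˢ z)
+ˢ-interchange u v w z = mk≈ λ m n → interchange (coeffˢ u m n) (coeffˢ v m n) (coeffˢ w m n) (coeffˢ z m n)
  where
  interchange : ∀ a b c d → (a ℤ.+ b) ℤ.+ (c ℤ.+ d) ≡ (a ℤ.+ c) ℤ.+ (b ℤ.+ d)
  interchange = solve-∀

-ˢ-cancel : ∀ {u v} → u ≈ v → u -ˢ v ≈ 0ˢ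
-ˢ-cancel {v = v} p = mk≈ λ m n →
  trans (cong (ℤ._+ ℤ.- coeffˢ v m n) (pointwise p m n)) (ℤ.+-inverseʳ (coeffˢ v m n))

α·-+ : ∀ u v → α· (u +ˢ v) ≈ α· u +ˢ α· v
α·-+ u v = mk≈ λ _ _ → refl

β·-+ : ∀ u v → β· (u +ˢ v) ≈ β· u +ˢ β· v
β·-+ u v = mk≈ λ _ _ → refl

α·β·-comm : ∀ u → α· β· u ≈ β· α· u
α·β·-comm u = mk≈ λ _ _ → refl

α·-0 : α· 0ˢ ≈ 0ˢ
α·-0 = mk≈ λ _ _ → refl

β·-0 : β· 0ˢ ≈ 0ˢ
β·-0 = mk≈ λ _ _ → refl

-ˢ-0 : -ˢ 0ˢ ≈ 0ˢ
-ˢ-0 = mk≈ λ _ _ → refl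

Σα : ℕ → (ℕ → Series) → Series
Σα zero T = 0ˢ
Σα (suc n) T = T 0 +ˢ α· Σα n (T ∘ suc)

Σα-cong : ∀ n {T T′} → (∀ t → T t ≈ T′ t) → Σα n T ≈ Σα n T′
Σα-cong zero h = ≈-refl
Σα-cong (suc n) h = +ˢ-cong (h 0) (α·-cong (Σα-cong n (h ∘ suc)))

Σα-0 : ∀ n → Σα n (const 0ˢ) ≈ 0ˢ
Σα-0 zero = ≈-refl
Σα-0 (suc n) = ≈-trans (+ˢ-congˡ (≈-trans (α·-cong (Σα-0 n)) α·-0)) (+ˢ-identityʳ 0ˢ)

Σα-+ : ∀ n T T′ → Σα n (λ t → T t +ˢ T′ t) ≈ Σα n T +ˢ Σα n T′
Σα-+ zero T T′ = ≈-sym (+ˢ-identityʳ 0ˢ)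
Σα-+ (suc n) T T′ = begin
  (T 0 +ˢ T′ 0) +ˢ α· Σα n (λ t → T (suc t) +ˢ T′ (suc t))
    ≈⟨ +ˢ-congˡ (α·-cong (Σα-+ n (T ∘ suc) (T′ ∘ suc))) ⟩
  (T 0 +ˢ T′ 0) +ˢ α· (Σα n (T ∘ suc) +ˢ Σα n (T′ ∘ suc))
    ≈⟨ +ˢ-congˡ (α·-+ _ _) ⟩
  (T 0 +ˢ T′ 0) +ˢ (α· Σα n (T ∘ suc) +ˢ α· Σα n (T′ ∘ suc))
    ≈⟨ +ˢ-interchange _ _ _ _ ⟩
  Σα (suc n) T +ˢ Σα (suc n) T′
    ∎

Σα-α : ∀ n T → Σα n (α·_ ∘ T) ≈ α· Σα n T
Σα-α zero T = ≈-sym α·-0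
Σα-α (suc n) T = ≈-trans (+ˢ-congˡ (α·-cong (Σα-α n (T ∘ suc)))) (≈-sym (α·-+ _ _))

Σα-β : ∀ n T → Σα n (β·_ ∘ T) ≈ β· Σα n T
Σα-β zero T = mk≈ λ _ _ → refl
Σα-β (suc n) T = begin
  β· T 0 +ˢ α· Σα n (β·_ ∘ T ∘ suc)  ≈⟨ +ˢ-congˡ (α·-cong (Σα-β n (T ∘ suc))) ⟩
  β· T 0 +ˢ α· β· Σα n (T ∘ suc)     ≈⟨ +ˢ-congˡ (α·β·-comm _) ⟩
  β· T 0 +ˢ β· α· Σα n (T ∘ suc)     ≈⟨ β·-+ _ _ ⟨
  β· Σα (suc n) T                     ∎

Σα-swap : ∀ n n′ (T : ℕ → ℕ → Series) →
  Σα n (λ t → Σα n′ (T t)) ≈ Σα n′ (λ s → Σα n (λ t → T t s))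
Σα-swap zero n′ T = ≈-sym (Σα-0 n′)
Σα-swap (suc n) n′ T = begin
  Σα n′ (T 0) +ˢ α· Σα n (λ t → Σα n′ (T (suc t)))
    ≈⟨ +ˢ-congˡ (α·-cong (Σα-swap n n′ (T ∘ suc))) ⟩
  Σα n′ (T 0) +ˢ α· Σα n′ (λ s → Σα n (λ t → T (suc t) s))
    ≈⟨ +ˢ-congˡ (Σα-α n′ _) ⟨
  Σα n′ (T 0) +ˢ Σα n′ (λ s → α· Σα n (λ t → T (suc t) s))
    ≈⟨ Σα-+ n′ _ _ ⟨
  Σα n′ (λ s → Σα (suc n) (λ t → T t s))
    ∎

-- The factor 1 + d on one box: u + β v if the box may be added (v being the
-- coefficient of the diagram with that box), u otherwise.
id+d : Bool → Series → Series → Series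
id+d b u v = u +ˢ (if b then β· v else 0ˢ)

id+d-cong : ∀ {b b′ u u′ v v′} → b ≡ b′ → u ≈ u′ → v ≈ v′ → id+d b u v ≈ id+d b′ u′ v′
id+d-cong {true} refl p q = +ˢ-cong p (β·-cong q)
id+d-cong {false} refl p q = +ˢ-congʳ p

id+d-0 : ∀ b → id+d b 0ˢ 0ˢ ≈ 0ˢ
id+d-0 true = mk≈ λ _ _ → refl
id+d-0 false = mk≈ λ _ _ → refl

id+d-+ : ∀ b u u′ v v′ → id+d b (u +ˢ u′) (v +ˢ v′) ≈ id+d b u v +ˢ id+d b u′ v′
id+d-+ true u u′ v v′ = ≈-trans (+ˢ-congˡ (β·-+ v v′)) (+ˢ-interchange u u′ (β· v) (β· v′))
id+d-+ false u u′ v v′ = begin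
  (u +ˢ u′) +ˢ 0ˢ          ≈⟨ +ˢ-identityʳ _ ⟩
  u +ˢ u′                  ≈⟨ +ˢ-cong (+ˢ-identityʳ u) (+ˢ-identityʳ u′) ⟨
  (u +ˢ 0ˢ) +ˢ (u′ +ˢ 0ˢ)  ∎

id+d-α : ∀ b u v → id+d b (α· u) (α· v) ≈ α· id+d b u v
id+d-α true u v = mk≈ λ _ _ → refl
id+d-α false u v = mk≈ λ _ _ → refl

id+d-β : ∀ b u v → id+d b (β· u) (β· v) ≈ β· id+d b u v
id+d-β true u v = mk≈ λ _ _ → refl
id+d-β false u v = mk≈ λ _ _ → refl

id+d-Σα : ∀ b n T T′ → id+d b (Σα n T) (Σα n T′) ≈ Σα n (λ t → id+d b (T t) (T′ t))
id+d-Σα true n T T′ = ≈-trans (+ˢ-congˡ (≈-sym (Σα-β n T′))) (≈-sym (Σα-+ n T (β·_ ∘ T′)))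
id+d-Σα false n T T′ = ≈-trans (+ˢ-identityʳ _) (Σα-cong n λ t → ≈-sym (+ˢ-identityʳ (T t)))

id+d-comm : ∀ b b′ p q r s → id+d b (id+d b′ p q) (id+d b′ r s) ≈ id+d b′ (id+d b p r) (id+d b q s)
id+d-comm true true p q r s = begin
  (p +ˢ β· q) +ˢ β· (r +ˢ β· s)      ≈⟨ +ˢ-congˡ (β·-+ r (β· s)) ⟩
  (p +ˢ β· q) +ˢ (β· r +ˢ β· β· s)  ≈⟨ +ˢ-interchange p (β· q) (β· r) (β· β· s) ⟩
  (p +ˢ β· r) +ˢ (β· q +ˢ β· β· s)  ≈⟨ +ˢ-congˡ (β·-+ q (β· s)) ⟨
  (p +ˢ β· r) +ˢ β· (q +ˢ β· s)      ∎
id+d-comm true false p q r s = ≈-trans (+ˢ-cong (+ˢ-identityʳ p) (β·-cong (+ˢ-identityʳ r))) (≈-sym (+ˢ-identityʳ _))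
id+d-comm false true p q r s = ≈-trans (+ˢ-identityʳ _) (≈-sym (+ˢ-cong (+ˢ-identityʳ p) (β·-cong (+ˢ-identityʳ q))))
id+d-comm false false p q r s = ≈-refl

rung : (ℕ → Bool) → (ℕ → Series) → ℕ → Series
rung c φ w = id+d (c w) (φ w) (φ (suc w))

-- ladder c φ L x = Σ_{L ≤ w < x} α^(x-1-w) · rung c φ w: the coefficient of
-- u(1 + d)φ at column length x, w running over the lengths it can grow from.
ladder : (ℕ → Bool) → (ℕ → Series) → ℕ → ℕ → Series
coeffˢ (ladder c φ L x) = coeffˢ (Σα (x ∸ L) (λ t → rung c φ (x ∸ suc t)))

ladder-Σα : ∀ c φ L x → ladder c φ L x ≈ Σα (x ∸ L) (λ t → rung c φ (x ∸ suc t))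
ladder-Σα c φ L x = mk≈ λ _ _ → refl

ladder-empty : ∀ c φ {L x} → x ≤ L → ladder c φ L x ≈ 0ˢ
ladder-empty c φ {L} {x} x≤L =
  ≈-trans (ladder-Σα c φ L x) (reflexive (cong (λ n → Σα n (λ t → rung c φ (x ∸ suc t))) (m≤n⇒m∸n≡0 x≤L)))

ladder-step : ∀ c φ {L x} → L ≤ x → ladder c φ L (suc x) ≈ rung c φ x +ˢ α· ladder c φ L x
ladder-step c φ {L} {x} L≤x =
  ≈-trans (ladder-Σα c φ L (suc x))
    (≈-trans (reflexive (cong (λ n → Σα n (λ t → rung c φ (suc x ∸ suc t))) (+-∸-assoc 1 L≤x)))
             (+ˢ-congˡ (α·-cong (≈-sym (ladder-Σα c φ L x)))))

ladder-cong : ∀ {c c′ φ ψ} L x →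
  (∀ w → L ≤ w → w < x → c w ≡ c′ w) → (∀ w → L ≤ w → w ≤ x → φ w ≈ ψ w) →
  ladder c φ L x ≈ ladder c′ ψ L x
ladder-cong {c} {c′} {φ} {ψ} L zero _ _ = ≈-trans (ladder-empty c φ {L} z≤n) (≈-sym (ladder-empty c′ ψ {L} z≤n))
ladder-cong {c} {c′} {φ} {ψ} L (suc x) hc hφ with L ≤? x
... | no L≰x = ≈-trans (ladder-empty c φ (≰⇒> L≰x)) (≈-sym (ladder-empty c′ ψ (≰⇒> L≰x)))
... | yes L≤x = begin
  ladder c φ L (suc x)              ≈⟨ ladder-step c φ L≤x ⟩
  rung c φ x +ˢ α· ladder c φ L x   ≈⟨ +ˢ-cong rung≈ (α·-cong (ladder-cong L x hc′ hφ′)) ⟩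
  rung c′ ψ x +ˢ α· ladder c′ ψ L x ≈⟨ ladder-step c′ ψ L≤x ⟨
  ladder c′ ψ L (suc x)             ∎
  where
  rung≈ = id+d-cong (hc x L≤x ≤-refl) (hφ x L≤x (m≤n⇒m≤1+n ≤-refl)) (hφ (suc x) (m≤n⇒m≤1+n L≤x) ≤-refl)
  hc′ = λ w L≤w w<x → hc w L≤w (m<n⇒m<1+n w<x)
  hφ′ = λ w L≤w w≤x → hφ w L≤w (m≤n⇒m≤1+n w≤x)

ladder-vanishes : ∀ c φ L x → (∀ w → L ≤ w → w ≤ x → φ w ≈ 0ˢ) → ladder c φ L x ≈ 0ˢ
ladder-vanishes c φ L x h = begin
  ladder c φ L x                   ≈⟨ ladder-cong {c′ = c} L x (λ _ _ _ → refl) h ⟩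
  ladder c (const 0ˢ) L x          ≈⟨ ladder-Σα c (const 0ˢ) L x ⟩
  Σα (x ∸ L) (λ t → rung c (const 0ˢ) (x ∸ suc t)) ≈⟨ Σα-cong (x ∸ L) (λ t → id+d-0 (c (x ∸ suc t))) ⟩
  Σα (x ∸ L) (const 0ˢ)            ≈⟨ Σα-0 (x ∸ L) ⟩
  0ˢ                               ∎

ladder-+ : ∀ c φ ψ L x → ladder c (λ w → φ w +ˢ ψ w) L x ≈ ladder c φ L x +ˢ ladder c ψ L x
ladder-+ c φ ψ L x = begin
  ladder c (λ w → φ w +ˢ ψ w) L x
    ≈⟨ ladder-Σα _ _ L x ⟩
  Σα N (λ t → rung c (λ w → φ w +ˢ ψ w) (x ∸ suc t))
    ≈⟨ Σα-cong N (λ t → id+d-+ (c (x ∸ suc t)) _ _ _ _) ⟩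
  Σα N (λ t → rung c φ (x ∸ suc t) +ˢ rung c ψ (x ∸ suc t))
    ≈⟨ Σα-+ N _ _ ⟩
  Σα N (λ t → rung c φ (x ∸ suc t)) +ˢ Σα N (λ t → rung c ψ (x ∸ suc t))
    ≈⟨ +ˢ-cong (ladder-Σα c φ L x) (ladder-Σα c ψ L x) ⟨
  ladder c φ L x +ˢ ladder c ψ L x
    ∎
  where N = x ∸ L

ladder-α : ∀ c φ L x → ladder c (α·_ ∘ φ) L x ≈ α· ladder c φ L x
ladder-α c φ L x = begin
  ladder c (α·_ ∘ φ) L x                        ≈⟨ ladder-Σα _ _ L x ⟩
  Σα N (λ t → rung c (α·_ ∘ φ) (x ∸ suc t))     ≈⟨ Σα-cong N (λ t → id+d-α (c (x ∸ suc t)) _ _) ⟩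
  Σα N (λ t → α· rung c φ (x ∸ suc t))          ≈⟨ Σα-α N _ ⟩
  α· Σα N (λ t → rung c φ (x ∸ suc t))          ≈⟨ α·-cong (ladder-Σα c φ L x) ⟨
  α· ladder c φ L x                             ∎
  where N = x ∸ L

ladder-β : ∀ c φ L x → ladder c (β·_ ∘ φ) L x ≈ β· ladder c φ L x
ladder-β c φ L x = begin
  ladder c (β·_ ∘ φ) L x                        ≈⟨ ladder-Σα _ _ L x ⟩
  Σα N (λ t → rung c (β·_ ∘ φ) (x ∸ suc t))     ≈⟨ Σα-cong N (λ t → id+d-β (c (x ∸ suc t)) _ _) ⟩
  Σα N (λ t → β· rung c φ (x ∸ suc t))          ≈⟨ Σα-β N _ ⟩
  β· Σα N (λ t → rung c φ (x ∸ suc t))          ≈⟨ β·-cong (ladder-Σα c φ L x) ⟨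
  β· ladder c φ L x                             ∎
  where N = x ∸ L

ladder-comm : ∀ c c′ (Γ : ℕ → ℕ → Series) L x L′ x′ →
  ladder c (λ w → ladder c′ (Γ w) L′ x′) L x ≈ ladder c′ (λ w′ → ladder c (λ w → Γ w w′) L x) L′ x′
ladder-comm c c′ Γ L x L′ x′ = begin
  ladder c (λ w → ladder c′ (Γ w) L′ x′) L x
    ≈⟨ ≈-trans (ladder-Σα _ _ L x) (Σα-cong N λ t →
         ≈-trans (id+d-cong refl (ladder-Σα _ _ L′ x′) (ladder-Σα _ _ L′ x′)) (id+d-Σα (c (w t)) N′ _ _)) ⟩
  Σα N (λ t → Σα N′ (λ s → outer-first t s))
    ≈⟨ Σα-swap N N′ outer-first ⟩
  Σα N′ (λ s → Σα N (λ t → outer-first t s))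
    ≈⟨ Σα-cong N′ (λ s → Σα-cong N (λ t → id+d-comm (c (w t)) (c′ (w′ s)) _ _ _ _)) ⟩
  Σα N′ (λ s → Σα N (λ t → inner-first t s))
    ≈⟨ ≈-trans (ladder-Σα _ _ L′ x′) (Σα-cong N′ λ s →
         ≈-trans (id+d-cong refl (ladder-Σα _ _ L x) (ladder-Σα _ _ L x)) (id+d-Σα (c′ (w′ s)) N _ _)) ⟨
  ladder c′ (λ w′ → ladder c (λ w → Γ w w′) L x) L′ x′
    ∎
  where
  N = x ∸ L
  N′ = x′ ∸ L′
  w = λ t → x ∸ suc t
  w′ = λ s → x′ ∸ suc s
  outer-first inner-first : ℕ → ℕ → Series
  outer-first t s = id+d (c (w t)) (rung c′ (Γ (w t)) (w′ s)) (rung c′ (Γ (suc (w t))) (w′ s))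
  inner-first t s = id+d (c′ (w′ s)) (rung c (λ v → Γ v (w′ s)) (w t)) (rung c (λ v → Γ v (suc (w′ s))) (w t))

-- Two adjacent columns

α-shift-agree : ∀ (F G : ℕ → Series) {y} →
  (∀ {x} → y ≤ x → F (suc x) ≈ α· F x) → (∀ {x} → y ≤ x → G (suc x) ≈ α· G x) →
  F y ≈ G y → ∀ {x} → y ≤ x → F x ≈ G x
α-shift-agree F G {y} stepF stepG base y≤x = go (≤⇒≤′ y≤x)
  where
  go : ∀ {x} → y ≤′ x → F x ≈ G x
  go ≤′-refl = base
  go (≤′-step y≤′x) = begin
    F (suc _)  ≈⟨ stepF (≤′⇒≤ y≤′x) ⟩
    α· F _     ≈⟨ α·-cong (go y≤′x) ⟩
    α· G _     ≈⟨ stepG (≤′⇒≤ y≤′x) ⟨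
    G (suc _)  ∎

-- H x y is the coefficient at the diagram whose two adjacent columns have
-- lengths x and y; a and b are the lower bounds that μ and the next column
-- impose on them.  Inside a partition a box can always be added to them.
module AdjacentColumns (a b : ℕ) where

  Grid : Set
  Grid = ℕ → ℕ → Series

  Uᵢ Uⱼ : Grid → Grid
  Uᵢ H x y = ladder (const true) (λ w → H w y) (y ⊔ a) x
  Uⱼ H x y = ladder (const true) (H x) b y

  commutator : Grid → Grid
  commutator H x y = Uᵢ (Uⱼ H) x y -ˢ Uⱼ (Uᵢ H) x y

  diag : Grid → ℕ → Series
  diag H y = Uⱼ (Uᵢ H) y y

  Uᵢ-empty : ∀ H x y → x ≤ y ⊔ a → Uᵢ H x y ≈ 0ˢ
  Uᵢ-empty H x y = ladder-empty (const true) (λ w → H w y)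

  Uᵢ-step : ∀ H x y → y ⊔ a ≤ x → Uᵢ H (suc x) y ≈ (H x y +ˢ β· H (suc x) y) +ˢ α· Uᵢ H x y
  Uᵢ-step H x y = ladder-step (const true) (λ w → H w y)

  Uⱼ-empty : ∀ H x y → y ≤ b → Uⱼ H x y ≈ 0ˢ
  Uⱼ-empty H x y = ladder-empty (const true) (H x)

  Uⱼ-step : ∀ H x y → b ≤ y → Uⱼ H x (suc y) ≈ (H x y +ˢ β· H x (suc y)) +ˢ α· Uⱼ H x y
  Uⱼ-step H x y = ladder-step (const true) (H x)

  Uᵢ-first-step : ∀ H {y} → a ≤ y → Uᵢ H (suc y) y ≈ H y y +ˢ β· H (suc y) y
  Uᵢ-first-step H {y} a≤y = begin
    Uᵢ H (suc y) y
      ≈⟨ Uᵢ-step H y y (⊔-lub ≤-refl a≤y) ⟩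
    (H y y +ˢ β· H (suc y) y) +ˢ α· Uᵢ H y y
      ≈⟨ +ˢ-congˡ (≈-trans (α·-cong (Uᵢ-empty H y y (m≤m⊔n y a))) α·-0) ⟩
    (H y y +ˢ β· H (suc y) y) +ˢ 0ˢ
      ≈⟨ +ˢ-identityʳ _ ⟩
    H y y +ˢ β· H (suc y) y
      ∎

  UⱼUᵢ-vanishes : ∀ H {x y} → x ≤ a → Uⱼ (Uᵢ H) x y ≈ 0ˢ
  UⱼUᵢ-vanishes H {x} {y} x≤a =
    ladder-vanishes (const true) (Uᵢ H x) b y λ w _ _ → Uᵢ-empty H x w (≤-trans x≤a (m≤n⊔m w a))

  UⱼUᵢ-step : ∀ H {x y} → y ⊔ a ≤ x →
    Uⱼ (Uᵢ H) (suc x) y ≈ (Uⱼ H x y +ˢ β· Uⱼ H (suc x) y) +ˢ α· Uⱼ (Uᵢ H) x y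
  UⱼUᵢ-step H {x} {y} y⊔a≤x = begin
    Uⱼ (Uᵢ H) (suc x) y
      ≈⟨ ladder-cong b y (λ _ _ _ → refl) (λ w _ w≤y → Uᵢ-step H x w (≤-trans (⊔-monoˡ-≤ a w≤y) y⊔a≤x)) ⟩
    ladder (const true) (λ w → (H x w +ˢ β· H (suc x) w) +ˢ α· Uᵢ H x w) b y
      ≈⟨ ladder-+ _ _ _ b y ⟩
    ladder (const true) (λ w → H x w +ˢ β· H (suc x) w) b y +ˢ ladder (const true) (λ w → α· Uᵢ H x w) b y
      ≈⟨ +ˢ-cong (ladder-+ _ _ _ b y) (ladder-α _ _ b y) ⟩
    (Uⱼ H x y +ˢ ladder (const true) (λ w → β· H (suc x) w) b y) +ˢ α· Uⱼ (Uᵢ H) x y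
      ≈⟨ +ˢ-congʳ (+ˢ-congˡ (ladder-β _ _ b y)) ⟩
    (Uⱼ H x y +ˢ β· Uⱼ H (suc x) y) +ˢ α· Uⱼ (Uᵢ H) x y
      ∎

  diag-step : ∀ H {y} → b ≤ y → diag H (suc y) ≈ Uᵢ H (suc y) y +ˢ α· Uⱼ (Uᵢ H) (suc y) y
  diag-step H {y} b≤y = begin
    diag H (suc y)
      ≈⟨ Uⱼ-step (Uᵢ H) (suc y) y b≤y ⟩
    (Uᵢ H (suc y) y +ˢ β· Uᵢ H (suc y) (suc y)) +ˢ α· Uⱼ (Uᵢ H) (suc y) y
      ≈⟨ +ˢ-congʳ (+ˢ-congˡ (≈-trans (β·-cong (Uᵢ-empty H (suc y) (suc y) (m≤m⊔n (suc y) a))) β·-0)) ⟩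
    (Uᵢ H (suc y) y +ˢ 0ˢ) +ˢ α· Uⱼ (Uᵢ H) (suc y) y
      ≈⟨ +ˢ-congʳ (+ˢ-identityʳ _) ⟩
    Uᵢ H (suc y) y +ˢ α· Uⱼ (Uᵢ H) (suc y) y
      ∎

  diag-Uᵢ-step : ∀ H {y} → b ≤ y →
    diag (Uᵢ H) (suc y) ≈ α· α· diag (Uᵢ H) y +ˢ (α· diag H y +ˢ β· diag H (suc y))
  diag-Uᵢ-step H {y} b≤y with a ≤? y
  ... | no a≰y = begin
    diag (Uᵢ H) (suc y)
      ≈⟨ UⱼUᵢ-vanishes (Uᵢ H) y<a ⟩
    0ˢ
      ≈⟨ mk≈ (λ _ _ → refl) ⟩
    α· α· 0ˢ +ˢ (α· 0ˢ +ˢ β· 0ˢ)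
      ≈⟨ +ˢ-cong (α·-cong (α·-cong (UⱼUᵢ-vanishes (Uᵢ H) y≤a)))
                 (+ˢ-cong (α·-cong (UⱼUᵢ-vanishes H y≤a)) (β·-cong (UⱼUᵢ-vanishes H y<a))) ⟨
    α· α· diag (Uᵢ H) y +ˢ (α· diag H y +ˢ β· diag H (suc y))
      ∎
    where
    y<a = ≰⇒> a≰y
    y≤a = ≤-trans (n≤1+n y) y<a
  ... | yes a≤y = begin
    diag (Uᵢ H) (suc y)
      ≈⟨ diag-step (Uᵢ H) b≤y ⟩
    Uᵢ (Uᵢ H) (suc y) y +ˢ α· Uⱼ (Uᵢ (Uᵢ H)) (suc y) y
      ≈⟨ +ˢ-cong (Uᵢ-first-step (Uᵢ H) a≤y) (α·-cong (UⱼUᵢ-step (Uᵢ H) (⊔-lub ≤-refl a≤y))) ⟩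
    (Uᵢ H y y +ˢ β· P) +ˢ α· ((diag H y +ˢ β· Q) +ˢ α· diag (Uᵢ H) y)
      ≈⟨ +ˢ-congʳ (≈-trans (+ˢ-congʳ (Uᵢ-empty H y y (m≤m⊔n y a))) (+ˢ-identityˡ _)) ⟩
    β· P +ˢ α· ((diag H y +ˢ β· Q) +ˢ α· diag (Uᵢ H) y)
      ≈⟨ mk≈ (λ m n → rearrange (coeffˢ (β· P) m n) (coeffˢ (α· β· Q) m n)
                                 (coeffˢ (α· diag H y) m n) (coeffˢ (α· α· diag (Uᵢ H) y) m n)) ⟩
    α· α· diag (Uᵢ H) y +ˢ (α· diag H y +ˢ β· (P +ˢ α· Q))
      ≈⟨ +ˢ-congˡ (+ˢ-congˡ (β·-cong (diag-step H b≤y))) ⟨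
    α· α· diag (Uᵢ H) y +ˢ (α· diag H y +ˢ β· diag H (suc y))
      ∎
    where
    P = Uᵢ H (suc y) y
    Q = Uⱼ (Uᵢ H) (suc y) y
    rearrange : ∀ p q d e → p ℤ.+ ((d ℤ.+ q) ℤ.+ e) ≡ e ℤ.+ (d ℤ.+ (p ℤ.+ q))
    rearrange = solve-∀

  commutator-vanishes : ∀ H {x y} → x ≤ a → commutator H x y ≈ 0ˢ
  commutator-vanishes H {x} {y} x≤a = begin
    Uᵢ (Uⱼ H) x y -ˢ Uⱼ (Uᵢ H) x y
      ≈⟨ +ˢ-cong (Uᵢ-empty (Uⱼ H) x y (≤-trans x≤a (m≤n⊔m y a))) (-ˢ-cong (UⱼUᵢ-vanishes H x≤a)) ⟩
    0ˢ -ˢ 0ˢ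
      ≈⟨ mk≈ (λ _ _ → refl) ⟩
    0ˢ
      ∎

  commutator-diagonal : ∀ H y → commutator H y y ≈ -ˢ diag H y
  commutator-diagonal H y = ≈-trans (+ˢ-congʳ (Uᵢ-empty (Uⱼ H) y y (m≤m⊔n y a))) (+ˢ-identityˡ _)

  commutator-shift : ∀ H {x y} → y ≤ x → commutator H (suc x) y ≈ α· commutator H x y
  commutator-shift H {x} {y} y≤x with y ⊔ a ≤? x
  ... | yes y⊔a≤x = begin
    Uᵢ (Uⱼ H) (suc x) y -ˢ Uⱼ (Uᵢ H) (suc x) y
      ≈⟨ +ˢ-cong (Uᵢ-step (Uⱼ H) x y y⊔a≤x) (-ˢ-cong (UⱼUᵢ-step H y⊔a≤x)) ⟩
    (S +ˢ α· Uᵢ (Uⱼ H) x y) -ˢ (S +ˢ α· Uⱼ (Uᵢ H) x y)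
      ≈⟨ mk≈ (λ m n → cancel (coeffˢ S m n) (coeffˢ (α· Uᵢ (Uⱼ H) x y) m n)
                              (coeffˢ (α· Uⱼ (Uᵢ H) x y) m n)) ⟩
    α· commutator H x y
      ∎
    where
    S = Uⱼ H x y +ˢ β· Uⱼ H (suc x) y
    cancel : ∀ s u v → (s ℤ.+ u) ℤ.+ ℤ.- (s ℤ.+ v) ≡ u ℤ.+ ℤ.- v
    cancel = solve-∀
  ... | no y⊔a≰x = begin
    commutator H (suc x) y  ≈⟨ commutator-vanishes H x<a ⟩
    0ˢ                      ≈⟨ α·-0 ⟨
    α· 0ˢ                   ≈⟨ α·-cong (commutator-vanishes H (≤-trans (n≤1+n x) x<a)) ⟨
    α· commutator H x y     ∎
    where
    x<a : x < a
    x<a = ≰⇒> (λ a≤x → y⊔a≰x (⊔-lub y≤x a≤x))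

  Uⱼ-commutator-shift : ∀ H {x y} → y ≤ x → Uⱼ (commutator H) (suc x) y ≈ α· Uⱼ (commutator H) x y
  Uⱼ-commutator-shift H {x} {y} y≤x =
    ≈-trans (ladder-cong b y (λ _ _ _ → refl) λ w _ w≤y → commutator-shift H (≤-trans w≤y y≤x))
            (ladder-α _ _ b y)

  Uⱼ-commutator-diagonal-empty : ∀ H {y} → y ≤ b → Uⱼ (commutator H) y y ≈ -ˢ diag (Uᵢ H) y
  Uⱼ-commutator-diagonal-empty H {y} y≤b = begin
    Uⱼ (commutator H) y y  ≈⟨ Uⱼ-empty (commutator H) y y y≤b ⟩
    0ˢ                     ≈⟨ -ˢ-0 ⟨
    -ˢ 0ˢ                  ≈⟨ -ˢ-cong (Uⱼ-empty (Uᵢ (Uᵢ H)) y y y≤b) ⟨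
    -ˢ diag (Uᵢ H) y       ∎

  Uⱼ-commutator-diagonal : ∀ H y → Uⱼ (commutator H) y y ≈ -ˢ diag (Uᵢ H) y
  Uⱼ-commutator-diagonal H zero = Uⱼ-commutator-diagonal-empty H z≤n
  Uⱼ-commutator-diagonal H (suc y) with b ≤? y
  ... | no b≰y = Uⱼ-commutator-diagonal-empty H (≰⇒> b≰y)
  ... | yes b≤y = begin
    Uⱼ (commutator H) (suc y) (suc y)
      ≈⟨ Uⱼ-step (commutator H) (suc y) y b≤y ⟩
    (commutator H (suc y) y +ˢ β· commutator H (suc y) (suc y)) +ˢ α· Uⱼ (commutator H) (suc y) y
      ≈⟨ +ˢ-cong (+ˢ-congʳ (commutator-shift H ≤-refl)) (α·-cong (Uⱼ-commutator-shift H ≤-refl)) ⟩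
    (α· commutator H y y +ˢ β· commutator H (suc y) (suc y)) +ˢ α· α· Uⱼ (commutator H) y y
      ≈⟨ +ˢ-cong (+ˢ-cong (α·-cong (commutator-diagonal H y)) (β·-cong (commutator-diagonal H (suc y))))
                 (α·-cong (α·-cong (Uⱼ-commutator-diagonal H y))) ⟩
    (α· -ˢ diag H y +ˢ β· -ˢ diag H (suc y)) +ˢ α· α· -ˢ diag (Uᵢ H) y
      ≈⟨ mk≈ (λ m n → negate (coeffˢ (α· diag H y) m n) (coeffˢ (β· diag H (suc y)) m n)
                              (coeffˢ (α· α· diag (Uᵢ H) y) m n)) ⟩
    -ˢ (α· α· diag (Uᵢ H) y +ˢ (α· diag H y +ˢ β· diag H (suc y)))
      ≈⟨ -ˢ-cong (diag-Uᵢ-step H b≤y) ⟨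
    -ˢ diag (Uᵢ H) (suc y)
      ∎
    where
    negate : ∀ u v w → (ℤ.- u ℤ.+ ℤ.- v) ℤ.+ ℤ.- w ≡ ℤ.- (w ℤ.+ (u ℤ.+ v))
    negate = solve-∀

  Uⱼ-commutator : ∀ H {x y} → y ≤ x → Uⱼ (commutator H) x y ≈ commutator (Uᵢ H) x y
  Uⱼ-commutator H {y = y} = α-shift-agree (λ x → Uⱼ (commutator H) x y) (λ x → commutator (Uᵢ H) x y)
    (Uⱼ-commutator-shift H) (commutator-shift (Uᵢ H))
    (≈-trans (Uⱼ-commutator-diagonal H y) (≈-sym (commutator-diagonal (Uᵢ H) y)))

⟦_⟧ : Poly → Series
coeffˢ ⟦ p ⟧ (+ m) (+ n) = coeff p m n
coeffˢ ⟦ p ⟧ (+ m) -[1+ n ] = 0ℤ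
coeffˢ ⟦ p ⟧ -[1+ m ] n = 0ℤ

⟦[]⟧ : ⟦ [] ⟧ ≈ 0ˢ
⟦[]⟧ = mk≈ λ where
  (+ m) (+ n) → refl
  (+ m) -[1+ n ] → refl
  -[1+ m ] n → refl

coeff-++ : ∀ p q m n → coeff (p ++ q) m n ≡ coeff p m n ℤ.+ coeff q m n
coeff-++ [] q m n = sym (ℤ.+-identityˡ _)
coeff-++ ((a , b , c) ∷ p) q m n with (a ≡ᵇ m) ∧ (b ≡ᵇ n)
... | true = trans (cong (λ z → c ℤ.+ z) (coeff-++ p q m n)) (sym (ℤ.+-assoc c _ _))
... | false = coeff-++ p q m n

⟦++⟧ : ∀ p q → ⟦ p ++ q ⟧ ≈ ⟦ p ⟧ +ˢ ⟦ q ⟧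
⟦++⟧ p q = mk≈ λ where
  (+ m) (+ n) → coeff-++ p q m n
  (+ m) -[1+ n ] → refl
  -[1+ m ] n → refl

coeff-negP : ∀ p m n → coeff (negP p) m n ≡ ℤ.- coeff p m n
coeff-negP [] m n = refl
coeff-negP ((a , b , c) ∷ p) m n with (a ≡ᵇ m) ∧ (b ≡ᵇ n)
... | true = trans (cong (λ z → ℤ.- c ℤ.+ z) (coeff-negP p m n)) (sym (ℤ.neg-distrib-+ c _))
... | false = coeff-negP p m n

⟦negP⟧ : ∀ p → ⟦ negP p ⟧ ≈ -ˢ ⟦ p ⟧
⟦negP⟧ p = mk≈ λ where
  (+ m) (+ n) → coeff-negP p m n
  (+ m) -[1+ n ] → refl
  -[1+ m ] n → refl

coeff-α-zero : ∀ p n → coeff (mulMono 1 0 p) 0 n ≡ 0ℤ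
coeff-α-zero [] n = refl
coeff-α-zero (_ ∷ p) n = coeff-α-zero p n

coeff-α-suc : ∀ p m n → coeff (mulMono 1 0 p) (suc m) n ≡ coeff p m n
coeff-α-suc [] m n = refl
coeff-α-suc ((a , b , c) ∷ p) m n with (a ≡ᵇ m) ∧ (b ≡ᵇ n)
... | true = cong (λ z → c ℤ.+ z) (coeff-α-suc p m n)
... | false = coeff-α-suc p m n

⟦mulMono-α⟧ : ∀ p → ⟦ mulMono 1 0 p ⟧ ≈ α· ⟦ p ⟧
⟦mulMono-α⟧ p = mk≈ λ where
  (+ zero) (+ n) → coeff-α-zero p n
  (+ suc m) (+ n) → coeff-α-suc p m n
  (+ zero) -[1+ n ] → refl
  (+ suc m) -[1+ n ] → refl
  -[1+ m ] n → refl

coeff-β-zero : ∀ p m → coeff (mulMono 0 1 p) m 0 ≡ 0ℤ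
coeff-β-zero [] m = refl
coeff-β-zero ((a , b , c) ∷ p) m with a ≡ᵇ m
... | true = coeff-β-zero p m
... | false = coeff-β-zero p m

coeff-β-suc : ∀ p m n → coeff (mulMono 0 1 p) m (suc n) ≡ coeff p m n
coeff-β-suc [] m n = refl
coeff-β-suc ((a , b , c) ∷ p) m n with (a ≡ᵇ m) ∧ (b ≡ᵇ n)
... | true = cong (λ z → c ℤ.+ z) (coeff-β-suc p m n)
... | false = coeff-β-suc p m n

⟦mulMono-β⟧ : ∀ p → ⟦ mulMono 0 1 p ⟧ ≈ β· ⟦ p ⟧
⟦mulMono-β⟧ p = mk≈ λ where
  (+ m) (+ zero) → coeff-β-zero p m
  (+ m) (+ suc n) → coeff-β-suc p m n
  (+ m) -[1+ n ] → refl
  -[1+ m ] (+ zero) → refl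
  -[1+ m ] (+ suc n) → refl
  -[1+ m ] -[1+ n ] → refl

mulMono-0 : ∀ p → mulMono 0 0 p ≡ p
mulMono-0 p = map-id p

mulMono-suc : ∀ a p → mulMono (suc a) 0 p ≡ mulMono 1 0 (mulMono a 0 p)
mulMono-suc a p = map-∘ p

concatMap-mulMono-suc : ∀ (F : ℕ → Poly) l →
  concatMap (λ a → mulMono (suc a) 0 (F a)) l ≡ mulMono 1 0 (concatMap (λ a → mulMono a 0 (F a)) l)
concatMap-mulMono-suc F [] = refl
concatMap-mulMono-suc F (a ∷ l) =
  trans (cong₂ _++_ (mulMono-suc a (F a)) (concatMap-mulMono-suc F l)) (sym (map-++ _ (mulMono a 0 (F a)) _))

⟦Σmono⟧ : ∀ n (F : ℕ → Poly) → ⟦ concatMap (λ a → mulMono a 0 (F a)) (upTo n) ⟧ ≈ Σα n (⟦_⟧ ∘ F)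
⟦Σmono⟧ zero F = ⟦[]⟧
⟦Σmono⟧ (suc n) F = begin
  ⟦ mulMono 0 0 (F 0) ++ concatMap G (applyUpTo suc n) ⟧
    ≈⟨ ⟦++⟧ _ _ ⟩
  ⟦ mulMono 0 0 (F 0) ⟧ +ˢ ⟦ concatMap G (applyUpTo suc n) ⟧
    ≡⟨ cong₂ (λ p q → ⟦ p ⟧ +ˢ ⟦ q ⟧) (mulMono-0 (F 0)) shift ⟩
  ⟦ F 0 ⟧ +ˢ ⟦ mulMono 1 0 (concatMap G′ (upTo n)) ⟧
    ≈⟨ +ˢ-congˡ (⟦mulMono-α⟧ _) ⟩
  ⟦ F 0 ⟧ +ˢ α· ⟦ concatMap G′ (upTo n) ⟧
    ≈⟨ +ˢ-congˡ (α·-cong (⟦Σmono⟧ n (F ∘ suc))) ⟩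
  Σα (suc n) (⟦_⟧ ∘ F)
    ∎
  where
  G = λ a → mulMono a 0 (F a)
  G′ = λ a → mulMono a 0 (F (suc a))
  shift : concatMap G (applyUpTo suc n) ≡ mulMono 1 0 (concatMap G′ (upTo n))
  shift = trans (cong (concatMap G) (sym (map-upTo suc n)))
                (trans (concatMap-map G suc (upTo n)) (concatMap-mulMono-suc (F ∘ suc) (upTo n)))

col-set0-same : ∀ l k v → col (set0 l k v) (suc k) ≡ v
col-set0-same [] zero v = refl
col-set0-same [] (suc k) v = col-set0-same [] k v
col-set0-same (x ∷ l) zero v = refl
col-set0-same (x ∷ l) (suc k) v = col-set0-same l k v

col-set0-other : ∀ l {k k′} v → k′ ≢ k → col (set0 l k v) (suc k′) ≡ col l (suc k′)
col-set0-other [] {zero} {zero} v k′≢k = ⊥-elim (k′≢k refl)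
col-set0-other [] {zero} {suc k′} v _ = refl
col-set0-other [] {suc k} {zero} v _ = refl
col-set0-other [] {suc k} {suc k′} v k′≢k = col-set0-other [] v (k′≢k ∘ cong suc)
col-set0-other (x ∷ l) {zero} {zero} v k′≢k = ⊥-elim (k′≢k refl)
col-set0-other (x ∷ l) {zero} {suc k′} v _ = refl
col-set0-other (x ∷ l) {suc k} {zero} v _ = refl
col-set0-other (x ∷ l) {suc k} {suc k′} v k′≢k = col-set0-other l v (k′≢k ∘ cong suc)

col-cons0 : ∀ x r k → col (cons0 x r) k ≡ col (x ∷ r) k
col-cons0 zero [] zero = refl
col-cons0 zero [] (suc zero) = refl
col-cons0 zero [] (suc (suc k)) = refl
col-cons0 zero (y ∷ r) k = refl
col-cons0 (suc x) r k = refl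

col-∷ : ∀ x {r l} → (∀ k → col r k ≡ col l k) → ∀ k → col (x ∷ r) k ≡ col (x ∷ l) k
col-∷ x h zero = refl
col-∷ x h (suc zero) = refl
col-∷ x h (suc (suc k)) = h (suc k)

col-strip : ∀ l k → col (strip l) k ≡ col l k
col-strip [] k = refl
col-strip (x ∷ l) k = trans (col-cons0 x (strip l) k) (col-∷ x (col-strip l) k)

strip-cong-col : ∀ l₁ l₂ → (∀ k → col l₁ (suc k) ≡ col l₂ (suc k)) → strip l₁ ≡ strip l₂
strip-cong-col [] [] h = refl
strip-cong-col [] (y ∷ l₂) h with h 0
... | refl = cong (cons0 0) (strip-cong-col [] l₂ (h ∘ suc))
strip-cong-col (x ∷ l₁) [] h with h 0
... | refl = cong (cons0 0) (strip-cong-col l₁ [] (h ∘ suc))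
strip-cong-col (x ∷ l₁) (y ∷ l₂) h = cong₂ cons0 (h 0) (strip-cong-col l₁ l₂ (h ∘ suc))

strip-positive : ∀ {l} → All (0 <_) l → strip l ≡ l
strip-positive [] = refl
strip-positive (s≤s z≤n ∷ ps) = cong (suc _ ∷_) (strip-positive ps)

col-antitone : ∀ {l} → Linked _≥_ l → ∀ i → 1 ≤ i → col l (suc i) ≤ col l i
col-antitone [] (suc i) _ = z≤n
col-antitone [-] (suc i) _ = z≤n
col-antitone (x≥y ∷ _) (suc zero) _ = x≥y
col-antitone (_ ∷ lk) (suc (suc i)) _ = col-antitone lk (suc i) (s≤s z≤n)

col-withCol-same : ∀ l {i} v → 1 ≤ i → col (withCol l i v) i ≡ v
col-withCol-same l {suc i} v _ = trans (col-strip (set0 l i v) (suc i)) (col-set0-same l i v)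

col-withCol-other : ∀ l {i k} v → 1 ≤ i → k ≢ i → col (withCol l i v) k ≡ col l k
col-withCol-other l {suc i} {zero} v _ _ = refl
col-withCol-other l {suc i} {suc k} v _ k≢i = trans (col-strip (set0 l i v) (suc k)) (col-set0-other l v (k≢i ∘ cong suc))

col-withCol-pred : ∀ l {i} v → 1 ≤ i → col (withCol l i v) (i ∸ 1) ≡ col l (i ∸ 1)
col-withCol-pred l {suc zero} v _ = refl
col-withCol-pred l {suc (suc i)} v 1≤i = col-withCol-other l v 1≤i (1+n≢n ∘ sym)

withCol-cong-col : ∀ l i v l′ i′ v′ → (∀ k → col (withCol l i v) (suc k) ≡ col (withCol l′ i′ v′) (suc k)) →
  withCol l i v ≡ withCol l′ i′ v′
withCol-cong-col l i v l′ i′ v′ h =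
  strip-cong-col s s′ λ k → trans (sym (col-strip s (suc k))) (trans (h k) (col-strip s′ (suc k)))
  where
  s = set0 l (i ∸ 1) v
  s′ = set0 l′ (i′ ∸ 1) v′

withCol-idem : ∀ l {i} v w → 1 ≤ i → withCol (withCol l i v) i w ≡ withCol l i w
withCol-idem l {i} v w 1≤i = withCol-cong-col (withCol l i v) i w l i w cols
  where
  cols : ∀ k → col (withCol (withCol l i v) i w) (suc k) ≡ col (withCol l i w) (suc k)
  cols k with suc k ≟ i
  ... | yes refl = trans (col-withCol-same (withCol l i v) w 1≤i) (sym (col-withCol-same l w 1≤i))
  ... | no k≢i = trans (col-withCol-other (withCol l i v) w 1≤i k≢i)
                   (trans (col-withCol-other l v 1≤i k≢i) (sym (col-withCol-other l w 1≤i k≢i)))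

withCol-comm : ∀ l {i k} v w → 1 ≤ i → 1 ≤ k → i ≢ k → withCol (withCol l i v) k w ≡ withCol (withCol l k w) i v
withCol-comm l {i} {k} v w 1≤i 1≤k i≢k = withCol-cong-col (withCol l i v) k w (withCol l k w) i v cols
  where
  cols : ∀ c → col (withCol (withCol l i v) k w) (suc c) ≡ col (withCol (withCol l k w) i v) (suc c)
  cols c with suc c ≟ k | suc c ≟ i
  ... | yes refl | yes refl = ⊥-elim (i≢k refl)
  ... | yes refl | no c≢i = trans (col-withCol-same (withCol l i v) w 1≤k)
                              (sym (trans (col-withCol-other (withCol l k w) v 1≤i c≢i) (col-withCol-same l w 1≤k)))
  ... | no c≢k | yes refl = trans (col-withCol-other (withCol l i v) w 1≤k c≢k)
                              (trans (col-withCol-same l v 1≤i) (sym (col-withCol-same (withCol l k w) v 1≤i)))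
  ... | no c≢k | no c≢i = trans (col-withCol-other (withCol l i v) w 1≤k c≢k)
                              (trans (col-withCol-other l v 1≤i c≢i)
                                (sym (trans (col-withCol-other (withCol l k w) v 1≤i c≢i) (col-withCol-other l w 1≤k c≢k))))

withCol-col : ∀ l {i} → 1 ≤ i → withCol l i (col l i) ≡ strip l
withCol-col l {suc i} _ = strip-cong-col (set0 l i (col l (suc i))) l cols
  where
  cols : ∀ k → col (set0 l i (col l (suc i))) (suc k) ≡ col l (suc k)
  cols k with k ≟ i
  ... | yes refl = col-set0-same l k _
  ... | no k≢i = col-set0-other l _ k≢i

-- The operators ũ_i

addable : ℕ → List ℕ → ℕ → Bool
addable i ν w = (i ≡ᵇ 1) ∨ (suc w ≤ᵇ col ν (i ∸ 1))

addable-cong : ∀ i ν ν′ w → col ν (i ∸ 1) ≡ col ν′ (i ∸ 1) → addable i ν w ≡ addable i ν′ w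
addable-cong i ν ν′ w = cong (λ z → (i ≡ᵇ 1) ∨ (suc w ≤ᵇ z))

addable-≤ : ∀ i ν {w} → suc w ≤ col ν (i ∸ 1) → addable i ν w ≡ true
addable-≤ i ν w<col = trans (cong ((i ≡ᵇ 1) ∨_) (Equivalence.to T-≡ (≤⇒≤ᵇ w<col))) (∨-zeroʳ (i ≡ᵇ 1))

addable-partition : ∀ {ν} → Linked _≥_ ν → ∀ i w → w < col ν i → addable i ν w ≡ true
addable-partition lk (suc zero) w _ = refl
addable-partition {ν} lk (suc (suc i)) w w<col =
  addable-≤ (suc (suc i)) ν (≤-trans w<col (col-antitone lk (suc i) (s≤s z≤n)))

⟦_⟧ᴹ : M → List ℕ → Series
⟦ f ⟧ᴹ ν = ⟦ f ν ⟧

ũ : List ℕ → ℕ → (List ℕ → Series) → List ℕ → Series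
ũ μ i G ν = ladder (addable i ν) (λ w → G (withCol ν i w)) (col ν (suc i) ⊔ col μ i) (col ν i)

⟦if-mulMono-β⟧ : ∀ b p → ⟦ if b then mulMono 0 1 p else [] ⟧ ≈ (if b then β· ⟦ p ⟧ else 0ˢ)
⟦if-mulMono-β⟧ true p = ⟦mulMono-β⟧ p
⟦if-mulMono-β⟧ false p = ⟦[]⟧

⟦D-withCol⟧ : ∀ μ {i} g ν w → 1 ≤ i →
  ⟦ D μ i g (withCol ν i w) ⟧ ≈ (if addable i ν w then β· ⟦ g (withCol ν i (suc w)) ⟧ else 0ˢ)
⟦D-withCol⟧ μ {i} g ν w 1≤i =
  ≈-trans (⟦if-mulMono-β⟧ (addable i νw (col νw i)) (g (withCol νw i (suc (col νw i)))))
          (reflexive (cong₂ (λ b ν′ → if b then β· ⟦ g ν′ ⟧ else 0ˢ) addable≡ grown≡))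
  where
  νw = withCol ν i w
  addable≡ : addable i νw (col νw i) ≡ addable i ν w
  addable≡ = trans (cong (addable i νw) (col-withCol-same ν w 1≤i)) (addable-cong i νw ν w (col-withCol-pred ν w 1≤i))
  grown≡ : withCol νw i (suc (col νw i)) ≡ withCol ν i (suc w)
  grown≡ = trans (cong (λ v → withCol νw i (suc v)) (col-withCol-same ν w 1≤i)) (withCol-idem ν w (suc w) 1≤i)

⟦Ut⟧ : ∀ μ {i} g ν → 1 ≤ i → ⟦ Ut μ i g ν ⟧ ≈ ũ μ i ⟦ g ⟧ᴹ ν
⟦Ut⟧ μ {i} g ν 1≤i = begin
  ⟦ Ut μ i g ν ⟧
    ≈⟨ ⟦Σmono⟧ N (λ t → (g ⊕ D μ i g) (withCol ν i (col ν i ∸ suc t))) ⟩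
  Σα N (λ t → ⟦ (g ⊕ D μ i g) (withCol ν i (col ν i ∸ suc t)) ⟧)
    ≈⟨ Σα-cong N (λ t → ≈-trans (⟦++⟧ _ _) (+ˢ-congˡ (⟦D-withCol⟧ μ g ν (col ν i ∸ suc t) 1≤i))) ⟩
  Σα N (λ t → rung (addable i ν) (λ w → ⟦ g (withCol ν i w) ⟧) (col ν i ∸ suc t))
    ≈⟨ ladder-Σα _ _ _ _ ⟨
  ũ μ i ⟦ g ⟧ᴹ ν
    ∎
  where N = col ν i ∸ (col ν (suc i) ⊔ col μ i)

ũ-cong : ∀ μ i {G G′} ν → (∀ ν′ → G ν′ ≈ G′ ν′) → ũ μ i G ν ≈ ũ μ i G′ ν
ũ-cong μ i ν h = ladder-cong _ _ (λ _ _ _ → refl) (λ w _ _ → h (withCol ν i w))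

ũ-as-ladder : ∀ μ k G ν {c φ L x} → col ν k ≡ x → col ν (suc k) ⊔ col μ k ≡ L →
  (∀ w → L ≤ w → w < x → addable k ν w ≡ c w) → (∀ w → L ≤ w → w ≤ x → G (withCol ν k w) ≈ φ w) →
  ũ μ k G ν ≈ ladder c φ L x
ũ-as-ladder μ k G ν refl refl = ladder-cong _ _

ũ-comm : ∀ μ {i k} G ν → 1 ≤ i → suc (suc i) ≤ k → ũ μ i (ũ μ k G) ν ≈ ũ μ k (ũ μ i G) ν
ũ-comm μ {i} {k@(suc (suc k′))} G ν 1≤i i+2≤k@(s≤s (s≤s i≤k′)) = begin
  ũ μ i (ũ μ k G) ν
    ≈⟨ ladder-cong Lᵢ xᵢ (λ _ _ _ → refl) (λ w _ _ → inner-k w) ⟩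
  ladder cᵢ (λ w → ladder cₖ (Γ w) Lₖ xₖ) Lᵢ xᵢ
    ≈⟨ ladder-comm cᵢ cₖ Γ Lᵢ xᵢ Lₖ xₖ ⟩
  ladder cₖ (λ w′ → ladder cᵢ (λ w → Γ w w′) Lᵢ xᵢ) Lₖ xₖ
    ≈⟨ ladder-cong Lₖ xₖ (λ _ _ _ → refl) (λ w′ _ _ → inner-i w′) ⟨
  ũ μ k (ũ μ i G) ν
    ∎
  where
  1≤k : 1 ≤ k
  1≤k = s≤s z≤n
  i<k-1 : i < suc k′
  i<k-1 = s≤s i≤k′
  i<k : i < k
  i<k = m<n⇒m<1+n i<k-1
  cᵢ = addable i ν
  cₖ = addable k ν
  Lᵢ = col ν (suc i) ⊔ col μ i
  Lₖ = col ν (suc k) ⊔ col μ k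
  xᵢ = col ν i
  xₖ = col ν k
  Γ : ℕ → ℕ → Series
  Γ w w′ = G (withCol (withCol ν i w) k w′)
  inner-k : ∀ w → ũ μ k G (withCol ν i w) ≈ ladder cₖ (Γ w) Lₖ xₖ
  inner-k w = ũ-as-ladder μ k G (withCol ν i w)
    (col-withCol-other ν w 1≤i (>⇒≢ i<k))
    (cong (_⊔ col μ k) (col-withCol-other ν w 1≤i (>⇒≢ (m<n⇒m<1+n i<k))))
    (λ w′ _ _ → addable-cong k (withCol ν i w) ν w′ (col-withCol-other ν w 1≤i (>⇒≢ i<k-1)))
    (λ _ _ _ → ≈-refl)
  inner-i : ∀ w′ → ũ μ i G (withCol ν k w′) ≈ ladder cᵢ (λ w → Γ w w′) Lᵢ xᵢ
  inner-i w′ = ũ-as-ladder μ i G (withCol ν k w′)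
    (col-withCol-other ν w′ 1≤k (<⇒≢ i<k))
    (cong (_⊔ col μ i) (col-withCol-other ν w′ 1≤k (<⇒≢ i+2≤k)))
    (λ w _ _ → addable-cong i (withCol ν k w′) ν w
                 (col-withCol-other ν w′ 1≤k (<⇒≢ (≤-trans (s≤s (m∸n≤m i 1)) i<k))))
    (λ w _ _ → reflexive (cong G (withCol-comm ν w′ w 1≤k 1≤i (>⇒≢ i<k))))

Ut-cong : ∀ μ {i g g′} ν → 1 ≤ i → (∀ ν′ → ⟦ g ν′ ⟧ ≈ ⟦ g′ ν′ ⟧) → ⟦ Ut μ i g ν ⟧ ≈ ⟦ Ut μ i g′ ν ⟧
Ut-cong μ {i} {g} {g′} ν 1≤i h = begin
  ⟦ Ut μ i g ν ⟧   ≈⟨ ⟦Ut⟧ μ g ν 1≤i ⟩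
  ũ μ i ⟦ g ⟧ᴹ ν   ≈⟨ ũ-cong μ i ν h ⟩
  ũ μ i ⟦ g′ ⟧ᴹ ν  ≈⟨ ⟦Ut⟧ μ g′ ν 1≤i ⟨
  ⟦ Ut μ i g′ ν ⟧  ∎

Ut-vanishes : ∀ μ {i} g ν → 1 ≤ i → (∀ ν′ → ⟦ g ν′ ⟧ ≈ 0ˢ) → ⟦ Ut μ i g ν ⟧ ≈ 0ˢ
Ut-vanishes μ {i} g ν 1≤i h = ≈-trans (⟦Ut⟧ μ g ν 1≤i) (ladder-vanishes _ _ _ _ (λ w _ _ → h (withCol ν i w)))

Ut-comm : ∀ μ {i k} g ν → 1 ≤ i → suc (suc i) ≤ k → ⟦ Ut μ i (Ut μ k g) ν ⟧ ≈ ⟦ Ut μ k (Ut μ i g) ν ⟧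
Ut-comm μ {i} {k} g ν 1≤i i+2≤k = begin
  ⟦ Ut μ i (Ut μ k g) ν ⟧  ≈⟨ ⟦Ut⟧ μ (Ut μ k g) ν 1≤i ⟩
  ũ μ i ⟦ Ut μ k g ⟧ᴹ ν    ≈⟨ ũ-cong μ i ν (λ ν′ → ⟦Ut⟧ μ g ν′ 1≤k) ⟩
  ũ μ i (ũ μ k ⟦ g ⟧ᴹ) ν   ≈⟨ ũ-comm μ ⟦ g ⟧ᴹ ν 1≤i i+2≤k ⟩
  ũ μ k (ũ μ i ⟦ g ⟧ᴹ) ν   ≈⟨ ũ-cong μ k ν (λ ν′ → ⟦Ut⟧ μ g ν′ 1≤i) ⟨
  ũ μ k ⟦ Ut μ i g ⟧ᴹ ν    ≈⟨ ⟦Ut⟧ μ (Ut μ i g) ν 1≤k ⟨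
  ⟦ Ut μ k (Ut μ i g) ν ⟧  ∎
  where 1≤k = ≤-trans 1≤i (≤-trans (n≤1+n i) (≤-trans (n≤1+n (suc i)) i+2≤k))

⟦⊖⟧ : ∀ f g ν → ⟦ (f ⊖ g) ν ⟧ ≈ ⟦ f ν ⟧ -ˢ ⟦ g ν ⟧
⟦⊖⟧ f g ν = ≈-trans (⟦++⟧ (f ν) _) (+ˢ-congˡ (⟦negP⟧ (g ν)))

-- On the diagrams obtained from ν by resetting columns i and i + 1 to lengths
-- x ≥ y, the operators ũ_i and ũ_(i+1) act as Uᵢ and Uⱼ.
module Slice (μ ν : List ℕ) {i : ℕ} (1≤i : 1 ≤ i) (addable-ν : ∀ w → w < col ν i → addable i ν w ≡ true) where

  j : ℕ
  j = suc i

  open AdjacentColumns (col μ i) (col ν (suc j) ⊔ col μ j)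

  slice : ℕ → ℕ → List ℕ
  slice x y = withCol (withCol ν i x) j y

  1≤j : 1 ≤ j
  1≤j = s≤s z≤n

  col-slice-i : ∀ {x y} → col (slice x y) i ≡ x
  col-slice-i {x} {y} = trans (col-withCol-other (withCol ν i x) y 1≤j (<⇒≢ ≤-refl)) (col-withCol-same ν x 1≤i)

  col-slice-j : ∀ {x y} → col (slice x y) j ≡ y
  col-slice-j {x} {y} = col-withCol-same (withCol ν i x) y 1≤j

  col-slice-other : ∀ {x y} k → k ≢ i → k ≢ j → col (slice x y) k ≡ col ν k
  col-slice-other {x} {y} k k≢i k≢j =
    trans (col-withCol-other (withCol ν i x) y 1≤j k≢j) (col-withCol-other ν x 1≤i k≢i)

  col-slice-pred : ∀ {x y} → col (slice x y) (i ∸ 1) ≡ col ν (i ∸ 1)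
  col-slice-pred {x} {y} =
    trans (col-withCol-other (withCol ν i x) y 1≤j (<⇒≢ (s≤s (m∸n≤m i 1)))) (col-withCol-pred ν x 1≤i)

  slice-withCol-i : ∀ {x y v} → withCol (slice x y) i v ≡ slice v y
  slice-withCol-i {x} {y} {v} =
    trans (withCol-comm (withCol ν i x) y v 1≤j 1≤i (>⇒≢ ≤-refl))
          (cong (λ l → withCol l j y) (withCol-idem ν x v 1≤i))

  slice-withCol-j : ∀ {x y w} → withCol (slice x y) j w ≡ slice x w
  slice-withCol-j {x} {y} {w} = withCol-idem (withCol ν i x) y w 1≤j

  slice-ν : strip ν ≡ ν → slice (col ν i) (col ν j) ≡ ν
  slice-ν stripped = trans (cong (λ l → withCol l j (col ν j)) (trans (withCol-col ν 1≤i) stripped))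
                           (trans (withCol-col ν 1≤j) stripped)

  record Represents (g : M) (H : Grid) : Set where
    constructor represents
    field on-slice : ∀ x y → y ≤ x → x ≤ col ν i → ⟦ g (slice x y) ⟧ ≈ H x y
  open Represents

  Ut-i-represents : ∀ {g H} → Represents g H → Represents (Ut μ i g) (Uᵢ H)
  Ut-i-represents {g} {H} r = represents λ x y y≤x x≤ν → ≈-trans (⟦Ut⟧ μ g (slice x y) 1≤i)
    (ũ-as-ladder μ i ⟦ g ⟧ᴹ (slice x y) col-slice-i (cong (_⊔ col μ i) col-slice-j)
      (λ w _ w<x → trans (addable-cong i (slice x y) ν w col-slice-pred) (addable-ν w (≤-trans w<x x≤ν)))
      (λ w y⊔a≤w w≤x → ≈-trans (reflexive (cong ⟦ g ⟧ᴹ slice-withCol-i))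
                                (on-slice r w y (m⊔n≤o⇒m≤o y (col μ i) y⊔a≤w) (≤-trans w≤x x≤ν))))

  Ut-j-represents : ∀ {g H} → Represents g H → Represents (Ut μ j g) (Uⱼ H)
  Ut-j-represents {g} {H} r = represents λ x y y≤x x≤ν → ≈-trans (⟦Ut⟧ μ g (slice x y) 1≤j)
    (ũ-as-ladder μ j ⟦ g ⟧ᴹ (slice x y) col-slice-j
      (cong (_⊔ col μ j) (col-slice-other (suc j) (>⇒≢ (m<n⇒m<1+n ≤-refl)) 1+n≢n))
      (λ w _ w<y → addable-≤ j (slice x y) (subst (suc w ≤_) (sym col-slice-i) (≤-trans w<y y≤x)))
      (λ w _ w≤y → ≈-trans (reflexive (cong ⟦ g ⟧ᴹ slice-withCol-j)) (on-slice r x w (≤-trans w≤y y≤x) x≤ν)))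

  ⊖-represents : ∀ {g H g′ H′} → Represents g H → Represents g′ H′ →
    Represents (g ⊖ g′) (λ x y → H x y -ˢ H′ x y)
  ⊖-represents {g} {g′ = g′} r r′ = represents λ x y y≤x x≤ν →
    ≈-trans (⟦⊖⟧ g g′ (slice x y)) (+ˢ-cong (on-slice r x y y≤x x≤ν) (-ˢ-cong (on-slice r′ x y y≤x x≤ν)))

  adjacent-relation : strip ν ≡ ν → col ν j ≤ col ν i → ∀ f →
    ⟦ Ut μ j (Ut μ i (Ut μ j f) ⊖ Ut μ j (Ut μ i f)) ν ⟧
      ≈ ⟦ (Ut μ i (Ut μ j (Ut μ i f)) ⊖ Ut μ j (Ut μ i (Ut μ i f))) ν ⟧
  adjacent-relation stripped y≤x f = begin
    ⟦ lhs ν ⟧                  ≡⟨ cong ⟦ lhs ⟧ᴹ (slice-ν stripped) ⟨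
    ⟦ lhs (slice x y) ⟧        ≈⟨ on-slice lhs-represents x y y≤x ≤-refl ⟩
    Uⱼ (commutator F) x y      ≈⟨ Uⱼ-commutator F y≤x ⟩
    commutator (Uᵢ F) x y      ≈⟨ on-slice rhs-represents x y y≤x ≤-refl ⟨
    ⟦ rhs (slice x y) ⟧        ≡⟨ cong ⟦ rhs ⟧ᴹ (slice-ν stripped) ⟩
    ⟦ rhs ν ⟧                  ∎
    where
    x = col ν i
    y = col ν j
    lhs = Ut μ j (Ut μ i (Ut μ j f) ⊖ Ut μ j (Ut μ i f))
    rhs = Ut μ i (Ut μ j (Ut μ i f)) ⊖ Ut μ j (Ut μ i (Ut μ i f))
    F : Grid
    F x y = ⟦ f (slice x y) ⟧
    f-represents : Represents f F
    f-represents = represents λ _ _ _ _ → ≈-refl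
    lhs-represents : Represents lhs (Uⱼ (commutator F))
    lhs-represents = Ut-j-represents (⊖-represents (Ut-i-represents (Ut-j-represents f-represents))
                                                    (Ut-j-represents (Ut-i-represents f-represents)))
    rhs-represents : Represents rhs (commutator (Uᵢ F))
    rhs-represents = ⊖-represents (Ut-i-represents (Ut-j-represents (Ut-i-represents f-represents)))
                                  (Ut-j-represents (Ut-i-represents (Ut-i-represents f-represents)))

relation-iii : ∀ μ ν {i j} → 1 ≤ i → i < j → IsPartition ν → (f : M) →
  ⟦ Ut μ j (Ut μ i (Ut μ j f) ⊖ Ut μ j (Ut μ i f)) ν ⟧
    ≈ ⟦ (Ut μ i (Ut μ j (Ut μ i f)) ⊖ Ut μ j (Ut μ i (Ut μ i f))) ν ⟧
relation-iii μ ν {i} {j} 1≤i i<j (decreasing , positive) f with j ≟ suc i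
... | yes refl =
  Slice.adjacent-relation μ ν 1≤i (addable-partition decreasing i) (strip-positive positive) (col-antitone decreasing i 1≤i) f
... | no j≢i+1 = ≈-trans lhs≈0 (≈-sym rhs≈0)
  where
  i+2≤j = ≤∧≢⇒< i<j (j≢i+1 ∘ sym)
  lhs≈0 : ⟦ Ut μ j (Ut μ i (Ut μ j f) ⊖ Ut μ j (Ut μ i f)) ν ⟧ ≈ 0ˢ
  lhs≈0 = Ut-vanishes μ (Ut μ i (Ut μ j f) ⊖ Ut μ j (Ut μ i f)) ν (≤-trans 1≤i (<⇒≤ i<j)) λ ν′ →
    ≈-trans (⟦⊖⟧ (Ut μ i (Ut μ j f)) (Ut μ j (Ut μ i f)) ν′) (-ˢ-cancel (Ut-comm μ f ν′ 1≤i i+2≤j))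
  rhs≈0 : ⟦ (Ut μ i (Ut μ j (Ut μ i f)) ⊖ Ut μ j (Ut μ i (Ut μ i f))) ν ⟧ ≈ 0ˢ
  rhs≈0 = ≈-trans (⟦⊖⟧ (Ut μ i (Ut μ j (Ut μ i f))) (Ut μ j (Ut μ i (Ut μ i f))) ν)
                  (-ˢ-cancel (Ut-comm μ (Ut μ i f) ν 1≤i i+2≤j))

EqM-from-≈ : ∀ {μ f g} → (∀ ν → IsPartition ν → ⟦ f ν ⟧ ≈ ⟦ g ν ⟧) → EqM μ f g
EqM-from-≈ h ν ν-partition _ m n = pointwise (h ν ν-partition) (+ m) (+ n)

theorem5p3 : (μ : List ℕ) → IsPartition μ →
      (∀ (i j k : ℕ) → 1 ≤ i → i < j → j < k → (f : M) →
        EqM μ (Ut μ i (Ut μ k (Ut μ j f))) (Ut μ k (Ut μ i (Ut μ j f))))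
    × (∀ (i j k : ℕ) → 1 ≤ i → i < j → j < k → (f : M) →
        EqM μ (Ut μ j (Ut μ k (Ut μ i f))) (Ut μ j (Ut μ i (Ut μ k f))))
    × (∀ (i j : ℕ) → 1 ≤ i → i < j → (f : M) →
        EqM μ (Ut μ j (Ut μ i (Ut μ j f) ⊖ Ut μ j (Ut μ i f)))
              (Ut μ i (Ut μ j (Ut μ i f)) ⊖ Ut μ j (Ut μ i (Ut μ i f))))
theorem5p3 μ _ =
    (λ i j k 1≤i i<j j<k f → EqM-from-≈ λ ν _ →
       Ut-comm μ (Ut μ j f) ν 1≤i (≤-trans (s≤s i<j) j<k))
  , (λ i j k 1≤i i<j j<k f → EqM-from-≈ λ ν _ →
       Ut-cong μ ν (≤-trans 1≤i (<⇒≤ i<j)) λ ν′ → ≈-sym (Ut-comm μ f ν′ 1≤i (≤-trans (s≤s i<j) j<k)))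
  , λ i j 1≤i i<j f → EqM-from-≈ λ ν ν-partition → relation-iii μ ν 1≤i i<j ν-partition f
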